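{- Let $\mathbf a=(a_n)_{n\ge0}$ be a sequence over a finite alphabet $\Omega$. If there exists $\ell\in\mathbb N$ with $\tilde p_{\mathbf a}(\ell)\le\ell$, then $\mathbf a$ is asymptotically invariant under a shift, i.e. there is $m\in\mathbb N$ with $(a_n)_{n\ge0}\simeq(a_{n+m})_{n\ge0}$. Conversely, if $\mathbf a$ is asymptotically invariant under a shift, then $\tilde p_{\mathbf a}(\ell)$ is bounded as $\ell\to\infty$.
   Context: Two sequences are asymptotically equal, $\mathbf a\simeq\mathbf b$, if $\frac1N\#\{0\le n<N:a_n\ne b_n\}\to0$. For a word $w\in\Omega^\ell$, $\overline{\mathrm{freq}}_{\mathbf a}(w)=\limsup_{N\to\infty}\frac1N\#\{0\le n<N: a_n\cdots a_{n+\ell-1}=w\}$, and $\tilde p_{\mathbf a}(\ell)=\#\{w\in\Omega^\ell:\overline{\mathrm{freq}}_{\mathbf a}(w)>0\}$. -}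

module Defs where

open import Level using (0ℓ)
open import Axiom.ExcludedMiddle using (ExcludedMiddle)
open import Data.Nat using (ℕ; zero; suc; _+_; _*_; _≤_; _<_)
open import Data.Fin using (Fin; toℕ)
open import Data.Fin.Properties using () renaming (_≟_ to _≟F_)
open import Data.Vec using (Vec; []; _∷_; tabulate)
open import Data.Vec.Properties using (≡-dec)
open import Data.List using (List; []; _∷_; map; concatMap; filter; length; allFin)
open import Data.Product using (Σ; ∃; ∃-syntax; _×_)
open import Relation.Nullary using (Dec; yes; no; ¬_)
open import Relation.Binary.PropositionalEquality using (_≡_)

-- Finite alphabet Ω is modelled as Fin k; a sequence is a function ℕ → Fin k.
Seq : ℕ → Set
Seq k = ℕ → Fin k

shift : ∀ {k} → ℕ → Seq k → Seq k
shift m a n = a (n + m)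

countBelow : {P : ℕ → Set} → ((n : ℕ) → Dec (P n)) → ℕ → ℕ
countBelow d zero = zero
countBelow d (suc N) with d N
... | yes _ = suc (countBelow d N)
... | no  _ = countBelow d N

diffCount : ∀ {k} → Seq k → Seq k → ℕ → ℕ
diffCount {k} a b = countBelow {P = λ n → ¬ (a n ≡ b n)} d
  where
  d : (n : ℕ) → Dec (¬ (a n ≡ b n))
  d n with a n ≟F b n
  ... | yes e = no (λ f → f e)
  ... | no ne = yes ne

-- asymptotic equality: (1/N) diffCount a b N → 0, i.e.
-- for every k, eventually (k+1) * diffCount N ≤ N.
_≃_ : ∀ {k} → Seq k → Seq k → Set
a ≃ b = ∀ (j : ℕ) → ∃[ N₀ ] (∀ N → N₀ ≤ N → suc j * diffCount a b N ≤ N)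

window : ∀ {k} → Seq k → (ℓ : ℕ) → ℕ → Vec (Fin k) ℓ
window a ℓ n = tabulate (λ i → a (n + toℕ i))

occCount : ∀ {k ℓ} → Seq k → Vec (Fin k) ℓ → ℕ → ℕ
occCount {k} {ℓ} a w = countBelow {P = λ n → window a ℓ n ≡ w}
  (λ n → ≡-dec _≟F_ (window a ℓ n) w)

-- upper frequency > 0:  limsup_N occCount N / N > 0, i.e.
-- there is j with occCount N / N > 1/(j+1) for infinitely many N.
PosUpperFreq : ∀ {k ℓ} → Seq k → Vec (Fin k) ℓ → Set
PosUpperFreq a w =
  ∃[ j ] (∀ N₀ → ∃[ N ] (N₀ ≤ N × N < suc j * occCount a w N))

allWords : (k ℓ : ℕ) → List (Vec (Fin k) ℓ)
allWords k zero = [] ∷ []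
allWords k (suc ℓ) = concatMap (λ i → map (i ∷_) (allWords k ℓ)) (allFin k)

-- p̃_a(ℓ) = #{w ∈ Ω^ℓ : upper frequency of w > 0}.  Positivity of the
-- upper frequency is not decidable, so the count uses excluded middle.
ptilde : ExcludedMiddle 0ℓ → ∀ {k} → Seq k → ℕ → ℕ
ptilde lem {k} a ℓ =
  length (filter (λ w → lem {PosUpperFreq a w}) (allWords k ℓ))

{-# OPTIONS --safe #-}
-- A word has positive upper frequency exactly when its occurrences do not form a set of
-- density zero. Suffixes of such words are such words, and each such word u has at least
-- one such left extension c u, so p̃(ℓ + 1), the sum over u of the number of positive left
-- extensions of u, is at least p̃(ℓ), strictly if some u is left special (has two).
-- As p̃(0) = 1, p̃(L) ≤ L forces a length i without left special words. Then, off a set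
-- of density zero, a_n is a function of the window a_{n+1} ⋯ a_{n+i}, so consecutive
-- windows obey a backward dynamics h on the K words of length i; since h^(K!+K) = h^K,
-- a_n = a_{n+K!} whenever the K! + K + 1 windows of length i + 1 starting at n are all
-- positive, hence off a set of density zero.
-- Conversely, if a ≃ shift m a, a positive word c u with |u| ≥ m occurs at some n with
-- a_n = a_{n+m}, so c is the m-th letter of u; no word of length ≥ m is left special and
-- p̃ stays at p̃(m) from m on.
module Submission where

open import Defs
open import Level using (0ℓ)
open import Axiom.ExcludedMiddle using (ExcludedMiddle)
open import Axiom.DoubleNegationElimination using (em⇒dne)
open import Data.Empty using (⊥-elim)
open import Data.Fin using (Fin; toℕ; fromℕ<) renaming (_≟_ to _≟F_)
open import Data.Fin.Properties using (pigeonhole; toℕ<n; toℕ-fromℕ<)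
open import Data.List using (List; []; _∷_; _++_; map; concatMap; filter; length; allFin)
import Data.List as List
open import Data.List.Properties using (map-++; map-cong; map-∘)
open import Data.List.Membership.Propositional using (_∈_; lose)
open import Data.List.Membership.Propositional.Properties using (∈-map⁺; ∈-concatMap⁺; ∈-allFin)
open import Data.List.Relation.Unary.Any using (Any; here; there; index)
open import Data.List.Relation.Unary.Any.Properties using (lookup-index)
import Data.List.Relation.Unary.All as All
open import Data.List.Relation.Unary.AllPairs using (_∷_)
open import Data.List.Relation.Unary.Unique.Propositional using (Unique)
open import Data.List.Relation.Unary.Unique.Propositional.Properties using (allFin⁺)
open import Data.Nat using (ℕ; zero; suc; _+_; _*_; _∸_; _!; _≤_; _<_; _≤?_; _≟_; z≤n; s≤s; z<s)
open import Data.Nat.Properties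
open import Algebra.Properties.CommutativeSemigroup +-commutativeSemigroup
  using (interchange; x∙yz≈y∙xz)
open import Data.Nat.Divisibility using (_∣_; ∣-trans; m∣m*n; m≤n⇒m!∣n!; quotient)
open import Data.Nat.GeneralisedArithmetic using (fold; fold-+)
open import Data.Nat.ListAction using (sum)
open import Data.Nat.ListAction.Properties using (sum-++)
open import Data.Product using (∃-syntax; _×_; _,_; proj₂)
open import Data.Sum using (_⊎_; inj₁; inj₂)
open import Data.Vec using (Vec; []; _∷_; lookup; truncate)
open import Data.Vec.Properties using (≡-dec; tabulate-cong; lookup∘tabulate; ∷-injective)
open import Function using (_∘_; id)
open import Relation.Nullary using (¬_; Dec; yes; no)
open import Relation.Nullary.Decidable using (decidable-stable)
open import Relation.Unary using (Pred; Decidable; _⊆_; _∪_; ∅)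
open import Relation.Unary.Properties using (_∪?_)
open import Relation.Binary.PropositionalEquality

-- Sets of density zero

-- a ≃ b unfolds to Negligible (diffCount a b), and PosUpperFreq a w to Frequent (occCount a w).
Negligible : (ℕ → ℕ) → Set
Negligible f = ∀ j → ∃[ N₀ ] (∀ N → N₀ ≤ N → suc j * f N ≤ N)

Frequent : (ℕ → ℕ) → Set
Frequent f = ∃[ j ] (∀ N₀ → ∃[ N ] (N₀ ≤ N × N < suc j * f N))

frequent⇒¬negligible : ∀ {f} → Frequent f → ¬ Negligible f
frequent⇒¬negligible (j , often) small with small j
... | N₀ , bound with often N₀
... | N , N₀≤N , N<jf = <⇒≱ N<jf (bound N N₀≤N)

negligible-≤ : ∀ {f g} → (∀ N → f N ≤ g N) → Negligible g → Negligible f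
negligible-≤ f≤g small j with small j
... | N₀ , bound = N₀ , λ N N₀≤N → ≤-trans (*-monoʳ-≤ (suc j) (f≤g N)) (bound N N₀≤N)

negligible-const : ∀ c → Negligible (λ _ → c)
negligible-const c j = suc j * c , λ _ le → le

negligible-double : ∀ {f} → Negligible f → ∀ j → ∃[ N₀ ] (∀ N → N₀ ≤ N → 2 * (suc j * f N) ≤ N)
negligible-double {f} small j with small (suc (2 * j))
... | N₀ , bound = N₀ , λ N le → ≤-trans (≤-reflexive (eq (f N))) (bound N le)
  where
  eq : ∀ x → 2 * (suc j * x) ≡ suc (suc (2 * j)) * x
  eq x = trans (sym (*-assoc 2 (suc j) x)) (cong (_* x) (*-distribˡ-+ 2 1 j))

negligible-+ : ∀ {f g} → Negligible f → Negligible g → Negligible (λ N → f N + g N)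
negligible-+ {f} {g} small-f small-g j
  with negligible-double small-f j | negligible-double small-g j
... | N₁ , bound-f | N₂ , bound-g = N₁ + N₂ , λ N le → *-cancelˡ-≤ 2 (begin
  2 * (suc j * (f N + g N))               ≡⟨ cong (2 *_) (*-distribˡ-+ (suc j) (f N) (g N)) ⟩
  2 * (suc j * f N + suc j * g N)         ≡⟨ *-distribˡ-+ 2 (suc j * f N) (suc j * g N) ⟩
  2 * (suc j * f N) + 2 * (suc j * g N)
    ≤⟨ +-mono-≤ (bound-f N (m+n≤o⇒m≤o N₁ le)) (bound-g N (m+n≤o⇒n≤o N₁ le)) ⟩
  N + N                                   ≡⟨ cong (N +_) (sym (+-identityʳ N)) ⟩
  2 * N                                   ∎)
  where open ≤-Reasoning

negligible-shift : ∀ {f} → Negligible f → ∀ t → Negligible (λ N → f (N + t))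
negligible-shift {f} small t j with negligible-double small j
... | N₀ , bound = N₀ + t , λ N le → *-cancelˡ-≤ 2 (begin
  2 * (suc j * f (N + t))   ≤⟨ bound (N + t) (≤-trans (m+n≤o⇒m≤o N₀ le) (m≤m+n N t)) ⟩
  N + t                     ≤⟨ +-monoʳ-≤ N (m+n≤o⇒n≤o N₀ le) ⟩
  N + N                     ≡⟨ cong (N +_) (sym (+-identityʳ N)) ⟩
  2 * N                     ∎)
  where open ≤-Reasoning

module _ {P Q : Pred ℕ 0ℓ} (P? : Decidable P) (Q? : Decidable Q) where

  countBelow-mono : P ⊆ Q → ∀ N → countBelow P? N ≤ countBelow Q? N
  countBelow-mono P⊆Q zero = z≤n
  countBelow-mono P⊆Q (suc N) with P? N | Q? N
  ... | yes _ | yes _ = s≤s (countBelow-mono P⊆Q N)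
  ... | yes p | no ¬q = ⊥-elim (¬q (P⊆Q p))
  ... | no _  | yes _ = m≤n⇒m≤1+n (countBelow-mono P⊆Q N)
  ... | no _  | no _  = countBelow-mono P⊆Q N

  countBelow-∪ : ∀ N → countBelow (P? ∪? Q?) N ≤ countBelow P? N + countBelow Q? N
  countBelow-∪ zero = z≤n
  countBelow-∪ (suc N) with P? N | Q? N
  ... | yes _ | yes _ = s≤s (≤-trans (countBelow-∪ N) (+-monoʳ-≤ (countBelow P? N) (n≤1+n _)))
  ... | yes _ | no _  = s≤s (countBelow-∪ N)
  ... | no _  | yes _ = ≤-trans (s≤s (countBelow-∪ N)) (≤-reflexive (sym (+-suc _ _)))
  ... | no _  | no _  = countBelow-∪ N

module _ {P : Pred ℕ 0ℓ} (P? : Decidable P) where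

  countBelow-shift : ∀ t N → countBelow (λ n → P? (n + t)) N ≤ countBelow P? (N + t)
  countBelow-shift t zero = z≤n
  countBelow-shift t (suc N) with P? (N + t)
  ... | yes _ = s≤s (countBelow-shift t N)
  ... | no _  = countBelow-shift t N

  countBelow-suc : ∀ N → countBelow P? N ≤ countBelow P? (suc N)
  countBelow-suc N with P? N
  ... | yes _ = n≤1+n _
  ... | no _  = ≤-refl

  countBelow-unshift : ∀ N → countBelow P? N ≤ 1 + countBelow (P? ∘ suc) N
  countBelow-unshift N = ≤-trans (countBelow-suc N) (from-suc N)
    where
    from-suc : ∀ N → countBelow P? (suc N) ≤ 1 + countBelow (P? ∘ suc) N
    from-suc zero with P? 0
    ... | yes _ = ≤-refl
    ... | no _  = z≤n
    from-suc (suc N) with P? (suc N)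
    ... | yes _ = s≤s (from-suc N)
    ... | no _  = from-suc N

  countBelow-∅ : (∀ n → ¬ P n) → ∀ N → countBelow P? N ≡ 0
  countBelow-∅ none zero = refl
  countBelow-∅ none (suc N) with P? N
  ... | yes p = ⊥-elim (none N p)
  ... | no _  = countBelow-∅ none N

  countBelow-all : (∀ n → P n) → ∀ N → countBelow P? N ≡ N
  countBelow-all all zero = refl
  countBelow-all all (suc N) with P? N
  ... | yes _ = cong suc (countBelow-all all N)
  ... | no ¬p = ⊥-elim (¬p (all N))

negligible-⊆ : ∀ {P Q : Pred ℕ 0ℓ} (P? : Decidable P) (Q? : Decidable Q) →
  P ⊆ Q → Negligible (countBelow Q?) → Negligible (countBelow P?)
negligible-⊆ P? Q? P⊆Q = negligible-≤ (countBelow-mono P? Q? P⊆Q)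

-- Finite sums

𝟙 : ∀ {P : Set} → Dec P → ℕ
𝟙 (yes _) = 1
𝟙 (no _)  = 0

module _ {P : Set} where

  𝟙-yes : (P? : Dec P) → P → 𝟙 P? ≡ 1
  𝟙-yes (yes _) _ = refl
  𝟙-yes (no ¬p) p = ⊥-elim (¬p p)

  𝟙-no : (P? : Dec P) → ¬ P → 𝟙 P? ≡ 0
  𝟙-no (yes p) ¬p = ⊥-elim (¬p p)
  𝟙-no (no _)  _  = refl

  𝟙≤1 : (P? : Dec P) → 𝟙 P? ≤ 1
  𝟙≤1 (yes _) = ≤-refl
  𝟙≤1 (no _)  = z≤n

  𝟙-witness : (P? : Dec P) → 1 ≤ 𝟙 P? → P
  𝟙-witness (yes p) _ = p

∑ : ∀ {A : Set} → List A → (A → ℕ) → ℕ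
∑ xs f = sum (map f xs)

module _ {A : Set} where

  length-filter : ∀ {P : Pred A 0ℓ} (P? : Decidable P) xs → length (filter P? xs) ≡ ∑ xs (𝟙 ∘ P?)
  length-filter P? [] = refl
  length-filter P? (x ∷ xs) with P? x
  ... | yes _ = cong suc (length-filter P? xs)
  ... | no _  = length-filter P? xs

  ∑-cong : ∀ xs {f g : A → ℕ} → (∀ x → f x ≡ g x) → ∑ xs f ≡ ∑ xs g
  ∑-cong xs f≗g = cong sum (map-cong f≗g xs)

  ∑-zero : ∀ (xs : List A) → ∑ xs (λ _ → 0) ≡ 0
  ∑-zero [] = refl
  ∑-zero (x ∷ xs) = ∑-zero xs

  ∑-+ : ∀ xs (f g : A → ℕ) → ∑ xs (λ x → f x + g x) ≡ ∑ xs f + ∑ xs g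
  ∑-+ [] f g = refl
  ∑-+ (x ∷ xs) f g = trans (cong (f x + g x +_) (∑-+ xs f g)) (interchange (f x) (g x) (∑ xs f) (∑ xs g))

  ∑-++ : ∀ xs ys (f : A → ℕ) → ∑ (xs ++ ys) f ≡ ∑ xs f + ∑ ys f
  ∑-++ xs ys f = trans (cong sum (map-++ f xs ys)) (sum-++ (map f xs) (map f ys))

module _ {A B : Set} where

  ∑-map : ∀ (g : A → B) xs (f : B → ℕ) → ∑ (map g xs) f ≡ ∑ xs (f ∘ g)
  ∑-map g xs f = cong sum (sym (map-∘ xs))

  ∑-concatMap : ∀ (g : A → List B) xs (f : B → ℕ) → ∑ (concatMap g xs) f ≡ ∑ xs (λ x → ∑ (g x) f)
  ∑-concatMap g [] f = refl
  ∑-concatMap g (x ∷ xs) f = trans (∑-++ (g x) (concatMap g xs) f) (cong (∑ (g x) f +_) (∑-concatMap g xs f))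

  ∑-swap : ∀ xs (ys : List B) (f : A → B → ℕ) →
    ∑ xs (λ x → ∑ ys (f x)) ≡ ∑ ys (λ y → ∑ xs (λ x → f x y))
  ∑-swap [] ys f = sym (∑-zero ys)
  ∑-swap (x ∷ xs) ys f = trans (cong (∑ ys (f x) +_) (∑-swap xs ys f)) (sym (∑-+ ys (f x) _))

module _ {A : Set} where

  ∑-mono : ∀ xs {f g : A → ℕ} → (∀ x → f x ≤ g x) → ∑ xs f ≤ ∑ xs g
  ∑-mono [] f≤g = z≤n
  ∑-mono (x ∷ xs) f≤g = +-mono-≤ (f≤g x) (∑-mono xs f≤g)

  ∑-mono-< : ∀ {xs} {f g : A → ℕ} {x} → (∀ x → f x ≤ g x) → x ∈ xs → f x < g x → ∑ xs f < ∑ xs g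
  ∑-mono-< {_ ∷ xs} f≤g (here refl) fx<gx = +-mono-<-≤ fx<gx (∑-mono xs f≤g)
  ∑-mono-< {y ∷ _} f≤g (there x∈xs) fx<gx = +-mono-≤-< (f≤g y) (∑-mono-< f≤g x∈xs fx<gx)

  ∑-member : ∀ {xs} (f : A → ℕ) {x} → x ∈ xs → f x ≤ ∑ xs f
  ∑-member {y ∷ xs} f (here refl) = m≤m+n (f y) _
  ∑-member {y ∷ xs} f (there x∈xs) = ≤-trans (∑-member f x∈xs) (m≤n+m _ (f y))

  ∑-pair : ∀ {xs} (f : A → ℕ) {x y} → x ∈ xs → y ∈ xs → x ≢ y → f x + f y ≤ ∑ xs f
  ∑-pair f (here refl) (here refl) x≢y = ⊥-elim (x≢y refl)
  ∑-pair {z ∷ _} f (here refl) (there y∈xs) _ = +-monoʳ-≤ (f z) (∑-member f y∈xs)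
  ∑-pair {z ∷ xs} f {x} (there x∈xs) (here refl) _ =
    subst (_≤ f z + ∑ xs f) (+-comm (f z) (f x)) (+-monoʳ-≤ (f z) (∑-member f x∈xs))
  ∑-pair {z ∷ _} f (there x∈xs) (there y∈xs) x≢y = ≤-trans (∑-pair f x∈xs y∈xs x≢y) (m≤n+m _ (f z))

  ∑-vanish : ∀ {xs} {f : A → ℕ} → (∀ {x} → x ∈ xs → f x ≡ 0) → ∑ xs f ≡ 0
  ∑-vanish {[]} _ = refl
  ∑-vanish {x ∷ xs} vanish = cong₂ _+_ (vanish (here refl)) (∑-vanish (vanish ∘ there))

  ∑-≤1 : ∀ {xs} {f : A → ℕ} → Unique xs → (∀ x → f x ≤ 1) →
    (∀ {x y} → 1 ≤ f x → 1 ≤ f y → x ≡ y) → ∑ xs f ≤ 1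
  ∑-≤1 {[]} _ _ _ = z≤n
  ∑-≤1 {y ∷ ys} {f} (y∉ys ∷ unique) f≤1 same with 1 ≤? f y
  ... | no fy≱1 = subst (λ z → z + ∑ ys f ≤ 1) (sym (n<1⇒n≡0 (≰⇒> fy≱1))) (∑-≤1 unique f≤1 same)
  ... | yes 1≤fy = subst (λ z → f y + z ≤ 1) (sym (∑-vanish rest-vanishes))
                     (≤-trans (≤-reflexive (+-identityʳ (f y))) (f≤1 y))
    where
    rest-vanishes : ∀ {x} → x ∈ ys → f x ≡ 0
    rest-vanishes {x} x∈ys with 1 ≤? f x
    ... | yes 1≤fx = ⊥-elim (All.lookup y∉ys x∈ys (same 1≤fy 1≤fx))
    ... | no fx≱1 = n<1⇒n≡0 (≰⇒> fx≱1)

-- Iterates of a self-map of a finite set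

m≤n⇒m∣n! : ∀ {m n} → 1 ≤ m → m ≤ n → m ∣ n !
m≤n⇒m∣n! {suc m} _ m≤n = ∣-trans (m∣m*n (m !)) (m≤n⇒m!∣n! m≤n)

module _ {A : Set} (h : A → A) where

  fold-periodic : ∀ {q} y → fold y h q ≡ y → ∀ c → fold y h (c * q) ≡ y
  fold-periodic y hq≡ zero = refl
  fold-periodic {q} y hq≡ (suc c) = begin
    fold y h (q + c * q)         ≡⟨ fold-+ y h q ⟩
    fold (fold y h (c * q)) h q  ≡⟨ cong (λ z → fold z h q) (fold-periodic y hq≡ c) ⟩
    fold y h q                   ≡⟨ hq≡ ⟩
    y                            ∎
    where open ≡-Reasoning

  -- Among the K + 1 points x, h x, …, h^K x two coincide; the gap q ≤ K divides K!.
  fold-eventually-periodic : ∀ (xs : List A) → (∀ x → x ∈ xs) →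
    ∀ x → let K = length xs in fold x h (K ! + K) ≡ fold x h K
  fold-eventually-periodic xs complete x
    with pigeonhole (n<1+n (length xs)) (λ t → index (complete (fold x h (toℕ t))))
  ... | t₁ , t₂ , t₁<t₂ , same-index = begin
    fold x h (K ! + K)                ≡⟨ fold-+ x h (K !) ⟩
    fold y h (K !)                    ≡⟨ cong (fold y h) (_∣_.equality q∣K!) ⟩
    fold y h (quotient q∣K! * q)      ≡⟨ fold-periodic y hq-y≡y (quotient q∣K!) ⟩
    y                                 ∎
    where
    open ≡-Reasoning
    K = length xs
    y = fold x h K
    q = toℕ t₂ ∸ toℕ t₁
    d = K ∸ toℕ t₁
    t₂≤K : toℕ t₂ ≤ K
    t₂≤K = ≤-pred (toℕ<n t₂)
    q+t₁≡t₂ : q + toℕ t₁ ≡ toℕ t₂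
    q+t₁≡t₂ = m∸n+n≡m (<⇒≤ t₁<t₂)
    d+t₁≡K : d + toℕ t₁ ≡ K
    d+t₁≡K = m∸n+n≡m (≤-trans (<⇒≤ t₁<t₂) t₂≤K)
    q∣K! : q ∣ K !
    q∣K! = m≤n⇒m∣n! (m<n⇒0<n∸m t₁<t₂) (≤-trans (m∸n≤m (toℕ t₂) (toℕ t₁)) t₂≤K)
    collision : fold x h (toℕ t₁) ≡ fold x h (toℕ t₂)
    collision = begin
      fold x h (toℕ t₁)                                    ≡⟨ lookup-index (complete _) ⟩
      List.lookup xs (index (complete (fold x h (toℕ t₁))))  ≡⟨ cong (List.lookup xs) same-index ⟩
      List.lookup xs (index (complete (fold x h (toℕ t₂))))  ≡⟨ lookup-index (complete _) ⟨
      fold x h (toℕ t₂)                                    ∎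
    hq-y≡y : fold y h q ≡ y
    hq-y≡y = begin
      fold y h q                         ≡⟨ fold-+ x h q ⟨
      fold x h (q + K)                   ≡⟨ cong (λ t → fold x h (q + t)) d+t₁≡K ⟨
      fold x h (q + (d + toℕ t₁))        ≡⟨ cong (fold x h) (x∙yz≈y∙xz q d (toℕ t₁)) ⟩
      fold x h (d + (q + toℕ t₁))        ≡⟨ fold-+ x h d ⟩
      fold (fold x h (q + toℕ t₁)) h d   ≡⟨ cong (λ t → fold (fold x h t) h d) q+t₁≡t₂ ⟩
      fold (fold x h (toℕ t₂)) h d       ≡⟨ cong (λ z → fold z h d) collision ⟨
      fold (fold x h (toℕ t₁)) h d       ≡⟨ fold-+ x h d ⟨
      fold x h (d + toℕ t₁)              ≡⟨ cong (fold x h) d+t₁≡K ⟩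
      y                                  ∎

-- Words of positive upper frequency

∈-allWords : ∀ {k} ℓ (w : Vec (Fin k) ℓ) → w ∈ allWords k ℓ
∈-allWords zero [] = here refl
∈-allWords {k} (suc ℓ) (c ∷ w) = ∈-concatMap⁺ (λ i → map (i ∷_) (allWords k ℓ))
  (lose (∈-allFin c) (∈-map⁺ (c ∷_) (∈-allWords ℓ w)))

module Classical (lem : ExcludedMiddle 0ℓ) where

  dne : ∀ {P : Set} → ¬ ¬ P → P
  dne = em⇒dne lem

  ¬frequent⇒negligible : ∀ {f} → ¬ Frequent f → Negligible f
  ¬frequent⇒negligible ¬often j = dne λ ¬bounded → ¬often (j , λ N₀ →
    dne λ ¬witness → ¬bounded (N₀ , λ N N₀≤N → ≮⇒≥ λ lt → ¬witness (N , N₀≤N , lt)))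

  Sparse : Pred ℕ 0ℓ → Set
  Sparse P = Negligible (countBelow (λ n → lem {P n}))

  module _ {P Q : Pred ℕ 0ℓ} where

    sparse-⊆ : P ⊆ Q → Sparse Q → Sparse P
    sparse-⊆ = negligible-⊆ _ _

    sparse-∪ : Sparse P → Sparse Q → Sparse (P ∪ Q)
    sparse-∪ sparse-P sparse-Q = negligible-≤
      (λ N → ≤-trans (countBelow-mono _ (P? ∪? Q?) id N) (countBelow-∪ P? Q? N))
      (negligible-+ sparse-P sparse-Q)
      where
      P? : Decidable P
      P? n = lem
      Q? : Decidable Q
      Q? n = lem

  sparse-∅ : Sparse ∅
  sparse-∅ = negligible-≤ (λ N → ≤-reflexive (countBelow-∅ _ (λ _ ()) N)) (negligible-const 0)

  module _ {P : Pred ℕ 0ℓ} where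

    sparse-shift : Sparse P → ∀ t → Sparse (λ n → P (n + t))
    sparse-shift sparse-P t = negligible-≤ (countBelow-shift _ t) (negligible-shift sparse-P t)

    sparse-unshift : Sparse (P ∘ suc) → Sparse P
    sparse-unshift sparse-P = negligible-≤ (countBelow-unshift _) (negligible-+ (negligible-const 1) sparse-P)

    sparse-within : Sparse P → ∀ M → Sparse (λ n → ∃[ s ] (s < M × P (s + n)))
    sparse-within sparse-P zero = sparse-⊆ (λ { (_ , () , _) }) sparse-∅
    sparse-within sparse-P (suc M) =
      sparse-⊆ split (sparse-∪ (sparse-within sparse-P M) (sparse-shift sparse-P M))
      where
      split : ∀ {n} → ∃[ s ] (s < suc M × P (s + n)) → ∃[ s ] (s < M × P (s + n)) ⊎ P (n + M)
      split {n} (s , s<1+M , p) with s ≟ M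
      ... | yes refl = inj₂ (subst P (+-comm s n) p)
      ... | no s≢M = inj₁ (s , ≤∧≢⇒< (≤-pred s<1+M) s≢M , p)

  sparse-Any : ∀ {A : Set} {P : A → Pred ℕ 0ℓ} → (∀ x → Sparse (P x)) →
    ∀ xs → Sparse (λ n → Any (λ x → P x n) xs)
  sparse-Any sparse-P [] = sparse-⊆ (λ ()) sparse-∅
  sparse-Any {P = P} sparse-P (x ∷ xs) = sparse-⊆ split (sparse-∪ (sparse-P x) (sparse-Any sparse-P xs))
    where
    split : ∀ {n} → Any (λ x → P x n) (x ∷ xs) → P x n ⊎ Any (λ x → P x n) xs
    split (here p) = inj₁ p
    split (there p) = inj₂ p

module _ {k : ℕ} (a : Seq k) where

  window-cons : ∀ ℓ n → window a (suc ℓ) n ≡ a n ∷ window a ℓ (suc n)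
  window-cons ℓ n = cong₂ _∷_ (cong a (+-identityʳ n)) (tabulate-cong (λ i → cong a (+-suc n (toℕ i))))

  truncate-window : ∀ {ℓ ℓ′} (ℓ≤ℓ′ : ℓ ≤ ℓ′) n → truncate ℓ≤ℓ′ (window a ℓ′ n) ≡ window a ℓ n
  truncate-window {zero} z≤n n = refl
  truncate-window {suc ℓ} {suc ℓ′} (s≤s ℓ≤ℓ′) n = begin
    truncate (s≤s ℓ≤ℓ′) (window a (suc ℓ′) n)  ≡⟨ cong (truncate (s≤s ℓ≤ℓ′)) (window-cons ℓ′ n) ⟩
    a n ∷ truncate ℓ≤ℓ′ (window a ℓ′ (suc n))  ≡⟨ cong (a n ∷_) (truncate-window ℓ≤ℓ′ (suc n)) ⟩
    a n ∷ window a ℓ (suc n)                    ≡⟨ window-cons ℓ n ⟨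
    window a (suc ℓ) n                          ∎
    where open ≡-Reasoning

  OccursAt : ∀ {ℓ} → Vec (Fin k) ℓ → Pred ℕ 0ℓ
  OccursAt {ℓ} w n = window a ℓ n ≡ w

  posUpperFreq-[] : PosUpperFreq a []
  posUpperFreq-[] = 1 , λ N₀ → suc N₀ , n≤1+n N₀ , (begin-strict
    suc N₀                          <⟨ m<m+n (suc N₀) z<s ⟩
    suc N₀ + suc N₀                 ≡⟨ cong (suc N₀ +_) (+-identityʳ (suc N₀)) ⟨
    2 * suc N₀
      ≡⟨ cong (2 *_) (countBelow-all (λ n → ≡-dec _≟F_ (window a 0 n) []) (λ _ → refl) (suc N₀)) ⟨
    2 * occCount a [] (suc N₀)      ∎)
    where open ≤-Reasoning

  module _ (lem : ExcludedMiddle 0ℓ) where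

    open Classical lem

    posUpperFreq⇒¬sparse : ∀ {ℓ} {w : Vec (Fin k) ℓ} → PosUpperFreq a w → ¬ Sparse (OccursAt w)
    posUpperFreq⇒¬sparse often sparse = frequent⇒¬negligible often (negligible-⊆ _ _ id sparse)

    ¬posUpperFreq⇒sparse : ∀ {ℓ} {w : Vec (Fin k) ℓ} → ¬ PosUpperFreq a w → Sparse (OccursAt w)
    ¬posUpperFreq⇒sparse ¬often = negligible-⊆ _ _ id (¬frequent⇒negligible ¬often)

    posUpperFreq-suffix : ∀ {ℓ} c (u : Vec (Fin k) ℓ) → PosUpperFreq a (c ∷ u) → PosUpperFreq a u
    posUpperFreq-suffix {ℓ} c u often = dne λ ¬often → posUpperFreq⇒¬sparse often
      (sparse-⊆ tail-occurs (sparse-shift (¬posUpperFreq⇒sparse ¬often) 1))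
      where
      tail-occurs : OccursAt (c ∷ u) ⊆ (λ n → OccursAt u (n + 1))
      tail-occurs {n} occ = subst (OccursAt u) (+-comm 1 n)
        (proj₂ (∷-injective (trans (sym (window-cons ℓ n)) occ)))

    sparse-¬posUpperFreq : ∀ ℓ → Sparse (λ n → ¬ PosUpperFreq a (window a ℓ n))
    sparse-¬posUpperFreq ℓ = sparse-⊆ (λ {n} ¬often → lose (∈-allWords ℓ (window a ℓ n)) (¬often , refl))
      (sparse-Any rare-occurrences (allWords k ℓ))
      where
      rare-occurrences : ∀ w → Sparse (λ n → ¬ PosUpperFreq a w × OccursAt w n)
      rare-occurrences w with lem {PosUpperFreq a w}
      ... | yes often = sparse-⊆ (λ (¬often , _) → ¬often often) sparse-∅
      ... | no ¬often = sparse-⊆ proj₂ (¬posUpperFreq⇒sparse ¬often)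

    posUpperFreq-extend : ∀ {ℓ} (u : Vec (Fin k) ℓ) → PosUpperFreq a u → ∃[ c ] PosUpperFreq a (c ∷ u)
    posUpperFreq-extend {ℓ} u often = dne λ no-extension → posUpperFreq⇒¬sparse often
      (sparse-unshift (sparse-⊆
        (λ {n} occ often′ → no-extension (a n , subst (PosUpperFreq a) (extended n occ) often′))
        (sparse-¬posUpperFreq (suc ℓ))))
      where
      extended : ∀ n → OccursAt u (suc n) → window a (suc ℓ) n ≡ a n ∷ u
      extended n occ = trans (window-cons ℓ n) (cong (a n ∷_) occ)

    posUpperFreq-avoids : ∀ {ℓ} {w : Vec (Fin k) ℓ} {Q : Pred ℕ 0ℓ} → PosUpperFreq a w → Sparse Q →
      ∃[ n ] (OccursAt w n × ¬ Q n)
    posUpperFreq-avoids often sparse-Q = dne λ never → posUpperFreq⇒¬sparse often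
      (sparse-⊆ (λ {n} occ → dne λ ¬q → never (n , occ , ¬q)) sparse-Q)

    -- The complexity function p̃

    ind : ∀ {ℓ} → Vec (Fin k) ℓ → ℕ
    ind w = 𝟙 (lem {PosUpperFreq a w})

    extensions : ∀ {ℓ} → Vec (Fin k) ℓ → ℕ
    extensions u = ∑ (allFin k) (λ c → ind (c ∷ u))

    ptilde≡∑ : ∀ ℓ → ptilde lem a ℓ ≡ ∑ (allWords k ℓ) ind
    ptilde≡∑ ℓ = length-filter (λ w → lem) (allWords k ℓ)

    ptilde-zero : ptilde lem a 0 ≡ 1
    ptilde-zero = trans (ptilde≡∑ 0) (cong (_+ 0) (𝟙-yes lem posUpperFreq-[]))

    ptilde-suc : ∀ ℓ → ptilde lem a (suc ℓ) ≡ ∑ (allWords k ℓ) extensions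
    ptilde-suc ℓ = begin
      ptilde lem a (suc ℓ)                                        ≡⟨ ptilde≡∑ (suc ℓ) ⟩
      ∑ (concatMap (λ c → map (c ∷_) (allWords k ℓ)) (allFin k)) ind
        ≡⟨ ∑-concatMap (λ c → map (c ∷_) (allWords k ℓ)) (allFin k) ind ⟩
      ∑ (allFin k) (λ c → ∑ (map (c ∷_) (allWords k ℓ)) ind)
        ≡⟨ ∑-cong (allFin k) (λ c → ∑-map (c ∷_) (allWords k ℓ) ind) ⟩
      ∑ (allFin k) (λ c → ∑ (allWords k ℓ) (λ u → ind (c ∷ u)))
        ≡⟨ ∑-swap (allFin k) (allWords k ℓ) (λ c u → ind (c ∷ u)) ⟩
      ∑ (allWords k ℓ) extensions                                 ∎
      where open ≡-Reasoning

    ind≤extensions : ∀ {ℓ} (u : Vec (Fin k) ℓ) → ind u ≤ extensions u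
    ind≤extensions u with lem {PosUpperFreq a u}
    ... | no _ = z≤n
    ... | yes often with posUpperFreq-extend u often
    ...   | c , often′ = subst (_≤ extensions u) (𝟙-yes lem often′)
                           (∑-member (λ c → ind (c ∷ u)) (∈-allFin c))

    ptilde-mono : ∀ ℓ → ptilde lem a ℓ ≤ ptilde lem a (suc ℓ)
    ptilde-mono ℓ = begin
      ptilde lem a ℓ                 ≡⟨ ptilde≡∑ ℓ ⟩
      ∑ (allWords k ℓ) ind           ≤⟨ ∑-mono (allWords k ℓ) ind≤extensions ⟩
      ∑ (allWords k ℓ) extensions    ≡⟨ ptilde-suc ℓ ⟨
      ptilde lem a (suc ℓ)           ∎
      where open ≤-Reasoning

    LeftSpecial : ∀ {ℓ} → Vec (Fin k) ℓ → Set
    LeftSpecial u = ∃[ c ] ∃[ c′ ] (c ≢ c′ × PosUpperFreq a (c ∷ u) × PosUpperFreq a (c′ ∷ u))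

    NoLeftSpecial : ℕ → Set
    NoLeftSpecial ℓ = ∀ (u : Vec (Fin k) ℓ) → ¬ LeftSpecial u

    ¬leftSpecial⇒extension-unique : ∀ {ℓ} {u : Vec (Fin k) ℓ} → ¬ LeftSpecial u →
      ∀ {c c′} → PosUpperFreq a (c ∷ u) → PosUpperFreq a (c′ ∷ u) → c ≡ c′
    ¬leftSpecial⇒extension-unique ¬leftSpecial {c} {c′} often often′ with c ≟F c′
    ... | yes c≡c′ = c≡c′
    ... | no c≢c′ = ⊥-elim (¬leftSpecial (c , c′ , c≢c′ , often , often′))

    leftSpecial⇒ptilde-< : ∀ {ℓ} (u : Vec (Fin k) ℓ) → LeftSpecial u → ptilde lem a ℓ < ptilde lem a (suc ℓ)
    leftSpecial⇒ptilde-< {ℓ} u (c , c′ , c≢c′ , often , often′) = begin-strict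
      ptilde lem a ℓ                 ≡⟨ ptilde≡∑ ℓ ⟩
      ∑ (allWords k ℓ) ind           <⟨ ∑-mono-< ind≤extensions (∈-allWords ℓ u) ind<extensions ⟩
      ∑ (allWords k ℓ) extensions    ≡⟨ ptilde-suc ℓ ⟨
      ptilde lem a (suc ℓ)           ∎
      where
      open ≤-Reasoning
      ind<extensions : ind u < extensions u
      ind<extensions = ≤-trans (s≤s (𝟙≤1 lem)) (subst (_≤ extensions u)
        (cong₂ _+_ (𝟙-yes lem often) (𝟙-yes lem often′))
        (∑-pair (λ c → ind (c ∷ u)) (∈-allFin c) (∈-allFin c′) c≢c′))

    noLeftSpecial⇒ptilde-≤ : ∀ {ℓ} → NoLeftSpecial ℓ → ptilde lem a (suc ℓ) ≤ ptilde lem a ℓ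
    noLeftSpecial⇒ptilde-≤ {ℓ} noLeftSpecial = begin
      ptilde lem a (suc ℓ)           ≡⟨ ptilde-suc ℓ ⟩
      ∑ (allWords k ℓ) extensions    ≤⟨ ∑-mono (allWords k ℓ) extensions≤ind ⟩
      ∑ (allWords k ℓ) ind           ≡⟨ ptilde≡∑ ℓ ⟨
      ptilde lem a ℓ                 ∎
      where
      open ≤-Reasoning
      extensions≤ind : ∀ u → extensions u ≤ ind u
      extensions≤ind u with lem {PosUpperFreq a u}
      ... | yes _ = ∑-≤1 (allFin⁺ k) (λ c → 𝟙≤1 lem)
          (λ p q → ¬leftSpecial⇒extension-unique (noLeftSpecial u) (𝟙-witness lem p) (𝟙-witness lem q))
      ... | no ¬often =
          ≤-reflexive (∑-vanish {xs = allFin k} λ {c} _ → 𝟙-no lem (¬often ∘ posUpperFreq-suffix c u))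

    ptilde≤length⇒noLeftSpecial : ∀ L → ptilde lem a L ≤ L → ∃[ i ] NoLeftSpecial i
    ptilde≤length⇒noLeftSpecial L ptilde≤L = dne λ never → <⇒≱ (grows never L) ptilde≤L
      where
      grows : ¬ (∃[ i ] NoLeftSpecial i) → ∀ ℓ → ℓ < ptilde lem a ℓ
      grows never zero = ≤-reflexive (sym ptilde-zero)
      grows never (suc ℓ) with dne (λ none → never (ℓ , λ u special → none (u , special)))
      ... | u , special = ≤-trans (s≤s (grows never ℓ)) (leftSpecial⇒ptilde-< u special)

    module _ {m} (invariant : a ≃ shift (suc m) a) where

      letter-determined : ∀ {ℓ} (m<ℓ : m < ℓ) c (u : Vec (Fin k) ℓ) →
        PosUpperFreq a (c ∷ u) → c ≡ lookup u (fromℕ< m<ℓ)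
      letter-determined {ℓ} m<ℓ c u often
        with posUpperFreq-avoids often (negligible-⊆ _ _ id invariant)
      ... | n , occ , ¬differs with ∷-injective (trans (sym (window-cons ℓ n)) occ)
      ...   | a[n]≡c , window≡u = begin
        c                                          ≡⟨ a[n]≡c ⟨
        a n                                        ≡⟨ decidable-stable (a n ≟F a (n + suc m)) ¬differs ⟩
        a (n + suc m)
          ≡⟨ cong a (trans (cong (suc n +_) (toℕ-fromℕ< m<ℓ)) (sym (+-suc n m))) ⟨
        a (suc n + toℕ (fromℕ< m<ℓ))
          ≡⟨ lookup∘tabulate (λ i → a (suc n + toℕ i)) (fromℕ< m<ℓ) ⟨
        lookup (window a ℓ (suc n)) (fromℕ< m<ℓ)   ≡⟨ cong (λ v → lookup v (fromℕ< m<ℓ)) window≡u ⟩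
        lookup u (fromℕ< m<ℓ)                      ∎
        where open ≡-Reasoning

      noLeftSpecial-beyond : ∀ {ℓ} → m < ℓ → NoLeftSpecial ℓ
      noLeftSpecial-beyond m<ℓ u (c , c′ , c≢c′ , often , often′) =
        c≢c′ (trans (letter-determined m<ℓ c u often) (sym (letter-determined m<ℓ c′ u often′)))

      ptilde-bounded : ∀ ℓ → ptilde lem a ℓ ≤ ptilde lem a (suc m)
      ptilde-bounded ℓ = begin
        ptilde lem a ℓ              ≤⟨ ptilde-mono-+ (suc m) ℓ ⟩
        ptilde lem a (suc m + ℓ)    ≡⟨ cong (ptilde lem a) (+-comm (suc m) ℓ) ⟩
        ptilde lem a (ℓ + suc m)    ≤⟨ ptilde-settled ℓ ⟩
        ptilde lem a (suc m)        ∎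
        where
        open ≤-Reasoning
        ptilde-mono-+ : ∀ d ℓ → ptilde lem a ℓ ≤ ptilde lem a (d + ℓ)
        ptilde-mono-+ zero ℓ = ≤-refl
        ptilde-mono-+ (suc d) ℓ = ≤-trans (ptilde-mono-+ d ℓ) (ptilde-mono (d + ℓ))
        ptilde-settled : ∀ d → ptilde lem a (d + suc m) ≤ ptilde lem a (suc m)
        ptilde-settled zero = ≤-refl
        ptilde-settled (suc d) =
          ≤-trans (noLeftSpecial⇒ptilde-≤ (noLeftSpecial-beyond (≤-trans (n<1+n m) (m≤n+m (suc m) d))))
                  (ptilde-settled d)

    module _ {i} (noLeftSpecial : NoLeftSpecial i) where

      predict : Vec (Fin k) i → Fin k
      predict u with lem {∃[ c ] PosUpperFreq a (c ∷ u)}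
      ... | yes (c , _) = c
      ... | no _ = a 0    -- arbitrary: u then has no positive left extension

      predict-correct : ∀ {c u} → PosUpperFreq a (c ∷ u) → predict u ≡ c
      predict-correct {c} {u} often with lem {∃[ c ] PosUpperFreq a (c ∷ u)}
      ... | yes (_ , often′) = ¬leftSpecial⇒extension-unique (noLeftSpecial u) often′ often
      ... | no none = ⊥-elim (none (c , often))

      back : Vec (Fin k) i → Vec (Fin k) i
      back u = truncate (n≤1+n i) (predict u ∷ u)

      Good : Pred ℕ 0ℓ
      Good n = PosUpperFreq a (window a (suc i) n)

      GoodRun : ℕ → ℕ → Set
      GoodRun n t = ∀ s → s < t → Good (s + n)

      good⇒letter : ∀ {n} → Good n → a n ≡ predict (window a i (suc n))
      good⇒letter {n} often = sym (predict-correct (subst (PosUpperFreq a) (window-cons i n) often))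

      good⇒back : ∀ {n} → Good n → window a i n ≡ back (window a i (suc n))
      good⇒back {n} good = begin
        window a i n                                      ≡⟨ truncate-window (n≤1+n i) n ⟨
        truncate (n≤1+n i) (window a (suc i) n)           ≡⟨ cong (truncate (n≤1+n i)) (window-cons i n) ⟩
        truncate (n≤1+n i) (a n ∷ window a i (suc n))
          ≡⟨ cong (λ c → truncate (n≤1+n i) (c ∷ window a i (suc n))) (good⇒letter good) ⟩
        back (window a i (suc n))                         ∎
        where open ≡-Reasoning

      goodRun-drop : ∀ {n} d {t} → GoodRun n (d + t) → GoodRun (d + n) t
      goodRun-drop {n} d run s s<t =
        subst Good (trans (+-assoc d s n) (x∙yz≈y∙xz d s n)) (run (d + s) (+-monoʳ-< d s<t))

      goodRun⇒fold-back : ∀ {n} t → GoodRun n t → window a i n ≡ fold (window a i (t + n)) back t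
      goodRun⇒fold-back zero run = refl
      goodRun⇒fold-back {n} (suc t) run = begin
        window a i n                                   ≡⟨ good⇒back (run 0 z<s) ⟩
        back (window a i (suc n))                      ≡⟨ cong back (goodRun⇒fold-back t (goodRun-drop 1 run)) ⟩
        back (fold (window a i (t + suc n)) back t)
          ≡⟨ cong (λ p → back (fold (window a i p) back t)) (+-suc t n) ⟩
        back (fold (window a i (suc t + n)) back t)    ∎
        where open ≡-Reasoning

      K Q : ℕ
      K = length (allWords k i)
      Q = K !

      goodRun⇒periodic : ∀ {n} → GoodRun n (suc (Q + K)) → a n ≡ a (n + Q)
      goodRun⇒periodic {n} run = begin
        a n                                        ≡⟨ good⇒letter (run 0 z<s) ⟩
        predict (window a i (suc n))               ≡⟨ cong predict windows-agree ⟩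
        predict (window a i (suc (Q + n)))         ≡⟨ good⇒letter (run Q (s≤s (m≤m+n Q K))) ⟨
        a (Q + n)                                  ≡⟨ cong a (+-comm Q n) ⟩
        a (n + Q)                                  ∎
        where
        open ≡-Reasoning
        windows-agree : window a i (suc n) ≡ window a i (suc Q + n)
        windows-agree = begin
          window a i (suc n)                                  ≡⟨ goodRun⇒fold-back (Q + K) (goodRun-drop 1 run) ⟩
          fold (window a i (Q + K + suc n)) back (Q + K)
            ≡⟨ fold-eventually-periodic back (allWords k i) (∈-allWords i) _ ⟩
          fold (window a i (Q + K + suc n)) back K            ≡⟨ cong (λ p → fold (window a i p) back K) position ⟩
          fold (window a i (K + (suc Q + n))) back K          ≡⟨ goodRun⇒fold-back K (goodRun-drop (suc Q) run) ⟨
          window a i (suc Q + n)                              ∎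
          where
          position : Q + K + suc n ≡ K + (suc Q + n)
          position = trans (cong (_+ suc n) (+-comm Q K)) (trans (+-assoc K Q (suc n)) (cong (K +_) (+-suc Q n)))

      shift-invariant : a ≃ shift Q a
      shift-invariant = negligible-⊆ _ _ differs⇒bad (sparse-within (sparse-¬posUpperFreq (suc i)) (suc (Q + K)))
        where
        differs⇒bad : ∀ {n} → ¬ a n ≡ a (n + Q) → ∃[ s ] (s < suc (Q + K) × ¬ Good (s + n))
        differs⇒bad differs =
          dne λ no-bad → differs (goodRun⇒periodic λ s s<M → dne λ bad → no-bad (s , s<M , bad))

proposition5p4 : (lem : ExcludedMiddle 0ℓ) → ∀ {k : ℕ} (a : Seq k) →
    ((∃[ ℓ ] (ptilde lem a ℓ ≤ ℓ)) → ∃[ m ] (1 ≤ m × a ≃ shift m a))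
    × ((∃[ m ] (1 ≤ m × a ≃ shift m a)) → ∃[ B ] (∀ ℓ → ptilde lem a ℓ ≤ B))
proposition5p4 lem a = low-complexity⇒invariant , invariant⇒bounded
  where
  low-complexity⇒invariant : ∃[ ℓ ] (ptilde lem a ℓ ≤ ℓ) → ∃[ m ] (1 ≤ m × a ≃ shift m a)
  low-complexity⇒invariant (L , ptilde≤L) with ptilde≤length⇒noLeftSpecial a lem L ptilde≤L
  ... | i , noLeftSpecial =
    Q a lem noLeftSpecial , 1≤n! (K a lem noLeftSpecial) , shift-invariant a lem noLeftSpecial
  invariant⇒bounded : ∃[ m ] (1 ≤ m × a ≃ shift m a) → ∃[ B ] (∀ ℓ → ptilde lem a ℓ ≤ B)
  invariant⇒bounded (suc m , _ , invariant) = ptilde lem a (suc m) , ptilde-bounded a lem invariant
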